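{- For every positive integer $\sigma'$ and every alphabet $\Sigma$ with at least $\sigma'$ characters, there exists a string $T$ over $\Sigma$ containing exactly $\sigma'$ distinct characters such that $|\mathcal{M}_2(T)|=\sigma'(\sigma'-2)+1$.
   Context: Here $T$ is a plain string over $\Sigma$ (no terminal symbols). A string $w\in\Sigma^*$ is a minimal absent word (MAW) for $T$ if $w$ does not occur as a substring of $T$ but every proper substring of $w$ occurs in $T$. $\mathcal{M}_2(T)$ is the set of MAWs for $T$ of the form $ab$ with $a,b\in\Sigma$, $a\neq b$. -}

module Defs where

open import Data.Nat using (ℕ; _<_)
open import Data.List using (List; []; _∷_; _++_; length)
open import Data.List.Membership.Propositional using (_∈_)
open import Data.List.Relation.Unary.Unique.Propositional using (Unique)
open import Data.Product using (Σ; ∃; ∃-syntax; _×_)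
open import Relation.Binary.PropositionalEquality using (_≡_; _≢_)
open import Relation.Nullary using (¬_)
open import Function.Bundles using (_⇔_)

Substring : {A : Set} → List A → List A → Set
Substring u w = ∃[ x ] ∃[ y ] (x ++ u ++ y ≡ w)

MAW : {A : Set} → List A → List A → Set
MAW w T = ¬ Substring w T
        × (∀ u → Substring u w → length u < length w → Substring u T)

InM₂ : {A : Set} → List A → A → A → Set
InM₂ T a b = MAW (a ∷ b ∷ []) T × a ≢ b

HasCard : {A : Set} → (A → Set) → ℕ → Set
HasCard {A} P k = Σ (List A) λ L → Unique L × (∀ x → (x ∈ L) ⇔ P x) × length L ≡ k

DistinctChars : {A : Set} → List A → ℕ → Set
DistinctChars T k = HasCard (λ c → c ∈ T) k

-- Take T = 0 1 … σ′−1. A word ab with a ≠ b is a minimal absent word of T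
-- iff both letters occur in T and ab is not a factor of T, i.e. b ≠ a + 1.
-- So M₂(T) consists of the pairs of [0,σ′)² off the diagonal and off the
-- line y = x + 1, and (x , y) ↦ (x + 1 , y) if y ≤ x, (x , y + 1) otherwise,
-- maps [0,σ′−1)² bijectively onto them: |M₂(T)| = (σ′−1)² = σ′(σ′−2)+1.

module Submission where

open import Defs
open import Data.Nat as ℕ using (ℕ; zero; suc; _≤_; _<_; z≤n; s≤s; _≤?_)
open import Data.Nat.Properties
  using (n<1+n; <-trans; <-≤-trans; <-cmp; <⇒≢; ≤⇒≯; ≰⇒>; ≤-pred; ≤∧≢⇒<;
         m<n⇒m≤1+n; m<n⇒m<1+n; suc-injective)
open import Data.Nat.DivMod using (_mod_; m<n⇒m%n≡m)
open import Data.Fin using (Fin; toℕ)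
open import Data.Fin.Properties using (toℕ-fromℕ<)
open import Data.Integer using (ℤ; +_; _-_; _*_; _+_)
import Data.Integer.Properties as ℤ
open import Data.Integer.Tactic.RingSolver using (solve-∀)
open import Data.List using (List; []; _∷_; length; map; applyUpTo; upTo; cartesianProduct)
open import Data.List.Properties using (length-map; length-++; length-applyUpTo; length-upTo; ∷-injectiveʳ)
open import Data.List.Membership.Propositional using (_∈_)
open import Data.List.Membership.Propositional.Properties
  using (∈-++⁺ˡ; ∈-++⁺ʳ; ∈-∃++; ∈-map⁺; ∈-map⁻; ∈-applyUpTo⁺; ∈-applyUpTo⁻;
         ∈-upTo⁺; ∈-upTo⁻; ∈-cartesianProduct⁺; ∈-cartesianProduct⁻)
open import Data.List.Relation.Unary.Any using (here; there)
open import Data.List.Relation.Unary.All using (All; []; _∷_)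
import Data.List.Relation.Unary.All as All
import Data.List.Relation.Unary.All.Properties as All
open import Data.List.Relation.Unary.AllPairs using ([]; _∷_)
open import Data.List.Relation.Unary.Unique.Propositional using (Unique)
open import Data.List.Relation.Unary.Unique.Propositional.Properties
  using (applyUpTo⁺₁; upTo⁺; cartesianProduct⁺)
open import Data.Product as Product using (Σ; ∃; _×_; _,_; proj₁; proj₂)
open import Relation.Nullary using (¬_; yes; no; contradiction)
open import Relation.Binary using (tri<; tri≈; tri>)
open import Relation.Binary.PropositionalEquality using (_≡_; _≢_; refl; sym; trans; cong; cong₂)
open import Function using (_∘′_)
open import Function.Bundles using (_⇔_; mk⇔; Equivalence)
open import Function.Construct.Identity using (⇔-id)

private
  variable
    A B : Set

open Equivalence using (to; from)

HasCard-image : {P : A → Set} {Q : B → Set} {m : ℕ} (g : A → B) →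
  (∀ {x y} → P x → P y → g x ≡ g y → x ≡ y) →
  (∀ y → Q y ⇔ ∃ λ x → P x × g x ≡ y) →
  HasCard P m → HasCard Q m
HasCard-image {P = P} {Q} g g-inj Q⇔image (L , L-unique , L⇔P , |L|≡m) =
  map g L , map-unique L-unique (All.tabulate (to (L⇔P _))) ,
  (λ y → mk⇔ (image⇒Q y) (Q⇒image y)) , trans (length-map g L) |L|≡m
  where
  map-unique : ∀ {xs} → Unique xs → All P xs → Unique (map g xs)
  map-unique [] [] = []
  map-unique (x∉xs ∷ xs-unique) (px ∷ pxs) =
    All.map⁺ (All.zipWith (λ (x≢y , py) gx≡gy → x≢y (g-inj px py gx≡gy)) (x∉xs , pxs))
      ∷ map-unique xs-unique pxs
  image⇒Q : ∀ y → y ∈ map g L → Q y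
  image⇒Q y y∈ with x , x∈L , refl ← ∈-map⁻ g y∈ = from (Q⇔image y) (x , to (L⇔P x) x∈L , refl)
  Q⇒image : ∀ y → Q y → y ∈ map g L
  Q⇒image y qy with x , px , refl ← to (Q⇔image y) qy = ∈-map⁺ g (from (L⇔P x) px)

Substring-∷ : ∀ {u w : List A} c → Substring u w → Substring u (c ∷ w)
Substring-∷ c (x , y , refl) = c ∷ x , y , refl

Substring-∈ : ∀ {u w : List A} {c} → Substring u w → c ∈ u → c ∈ w
Substring-∈ (x , y , refl) c∈u = ∈-++⁺ʳ x (∈-++⁺ˡ c∈u)

∈⇒Substring : ∀ {w : List A} {c} → c ∈ w → Substring (c ∷ []) w
∈⇒Substring c∈w with x , y , refl ← ∈-∃++ c∈w = x , y , refl

short-Substring : ∀ {w : List A} u → length u < 2 → All (_∈ w) u → Substring u w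
short-Substring {w = w} [] _ [] = [] , w , refl
short-Substring (c ∷ []) _ (c∈w ∷ []) = ∈⇒Substring c∈w
short-Substring (_ ∷ _ ∷ _) (s≤s (s≤s ())) _

InM₂⇔ : ∀ {T : List A} {a b} →
  InM₂ T a b ⇔ (a ∈ T × b ∈ T × ¬ Substring (a ∷ b ∷ []) T × a ≢ b)
InM₂⇔ {T = T} {a} {b} = mk⇔
  (λ ((absent , minimal) , a≢b) →
     Substring-∈ (minimal (a ∷ []) ([] , b ∷ [] , refl) (s≤s (s≤s z≤n))) (here refl) ,
     Substring-∈ (minimal (b ∷ []) (a ∷ [] , [] , refl) (s≤s (s≤s z≤n))) (here refl) ,
     absent , a≢b)
  (λ (a∈T , b∈T , absent , a≢b) →
     (absent , λ u u⊑ab |u|<2 →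
        short-Substring u |u|<2 (All.tabulate (λ c∈u → letter a∈T b∈T (Substring-∈ u⊑ab c∈u)))) ,
     a≢b)
  where
  letter : a ∈ T → b ∈ T → ∀ {c} → c ∈ a ∷ b ∷ [] → c ∈ T
  letter a∈T _ (here refl) = a∈T
  letter _ b∈T (there (here refl)) = b∈T

Substring-applyUpTo⁺ : ∀ (f : ℕ → A) {i k} → suc i < k →
  Substring (f i ∷ f (suc i) ∷ []) (applyUpTo f k)
Substring-applyUpTo⁺ f {zero} {suc zero} (s≤s ())
Substring-applyUpTo⁺ f {zero} {suc (suc k)} _ = [] , applyUpTo (f ∘′ suc ∘′ suc) k , refl
Substring-applyUpTo⁺ f {suc i} {suc k} (s≤s i<k) = Substring-∷ (f 0) (Substring-applyUpTo⁺ (f ∘′ suc) i<k)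

Substring-applyUpTo⁻ : ∀ (f : ℕ → A) {a b} k → Substring (a ∷ b ∷ []) (applyUpTo f k) →
  ∃ λ i → suc i < k × a ≡ f i × b ≡ f (suc i)
Substring-applyUpTo⁻ f (suc (suc k)) ([] , _ , refl) = 0 , s≤s (s≤s z≤n) , refl , refl
Substring-applyUpTo⁻ f (suc k) (_ ∷ x , y , eq)
  with i , i<k , refl , refl ← Substring-applyUpTo⁻ (f ∘′ suc) k (x , y , ∷-injectiveʳ eq) =
  suc i , s≤s i<k , refl , refl

length-cartesianProduct : ∀ (xs : List A) (ys : List B) →
  length (cartesianProduct xs ys) ≡ length xs ℕ.* length ys
length-cartesianProduct [] ys = refl
length-cartesianProduct (x ∷ xs) ys = trans (length-++ (map (x ,_) ys))
  (cong₂ ℕ._+_ (length-map (x ,_) ys) (length-cartesianProduct xs ys))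

Square : ℕ → ℕ × ℕ → Set
Square j (x , y) = x < j × y < j

Square-card : ∀ j → HasCard (Square j) (j ℕ.* j)
Square-card j =
  cartesianProduct (upTo j) (upTo j) , cartesianProduct⁺ (upTo⁺ j) (upTo⁺ j) ,
  (λ (x , y) → mk⇔ (Product.map ∈-upTo⁻ ∈-upTo⁻ ∘′ ∈-cartesianProduct⁻ (upTo j) (upTo j))
                   (λ (x<j , y<j) → ∈-cartesianProduct⁺ (∈-upTo⁺ x<j) (∈-upTo⁺ y<j))) ,
  trans (length-cartesianProduct (upTo j) (upTo j)) (cong₂ ℕ._*_ (length-upTo j) (length-upTo j))

AbsentPair : ℕ → ℕ × ℕ → Set
AbsentPair k (x , y) = x < k × y < k × x ≢ y × y ≢ suc x

toAbsentPair : ℕ × ℕ → ℕ × ℕ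
toAbsentPair (x , y) with y ≤? x
... | yes _ = suc x , y
... | no _ = x , suc y

toAbsentPair-≤ : ∀ {x y} → y ≤ x → toAbsentPair (x , y) ≡ (suc x , y)
toAbsentPair-≤ {x} {y} y≤x with y ≤? x
... | yes _ = refl
... | no y≰x = contradiction y≤x y≰x

toAbsentPair-> : ∀ {x y} → x < y → toAbsentPair (x , y) ≡ (x , suc y)
toAbsentPair-> {x} {y} x<y with y ≤? x
... | yes y≤x = contradiction x<y (≤⇒≯ y≤x)
... | no _ = refl

toAbsentPair-injective : ∀ p q → toAbsentPair p ≡ toAbsentPair q → p ≡ q
toAbsentPair-injective (x , y) (x′ , y′) eq with y ≤? x | y′ ≤? x′ | eq
... | yes _ | yes _ | refl = refl
... | no _ | no _ | refl = refl
... | yes y≤x | no y′≰x′ | refl = contradiction (m<n⇒m≤1+n y≤x) y′≰x′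
... | no y≰x | yes y′≤x′ | refl = contradiction (m<n⇒m≤1+n y′≤x′) y≰x

Square⇒AbsentPair : ∀ {j} p → Square j p → AbsentPair (suc j) (toAbsentPair p)
Square⇒AbsentPair (x , y) (x<j , y<j) with y ≤? x
... | yes y≤x = s≤s x<j , m<n⇒m<1+n y<j , (λ eq → <⇒≢ (s≤s y≤x) (sym eq)) , <⇒≢ (m<n⇒m<1+n (s≤s y≤x))
... | no y≰x = let x<y = ≰⇒> y≰x in
  m<n⇒m<1+n x<j , s≤s y<j , <⇒≢ (m<n⇒m<1+n x<y) , (λ eq → <⇒≢ x<y (sym (suc-injective eq)))

AbsentPair⇒Square : ∀ {j} q → AbsentPair (suc j) q → ∃ λ p → Square j p × toAbsentPair p ≡ q
AbsentPair⇒Square (a , b) (a<k , b<k , a≢b , b≢1+a) with <-cmp a b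
... | tri≈ _ a≡b _ = contradiction a≡b a≢b
AbsentPair⇒Square (suc x , b) (s≤s x<j , b<k , _) | tri> _ _ b<1+x =
  (x , b) , (x<j , <-≤-trans b<1+x x<j) , toAbsentPair-≤ (≤-pred b<1+x)
AbsentPair⇒Square (a , suc y) (a<k , s≤s y<j , _ , b≢1+a) | tri< a<1+y _ _ =
  (a , y) , (<-trans a<y y<j , y<j) , toAbsentPair-> a<y
  where
  a<y : a < y
  a<y = ≤∧≢⇒< (≤-pred a<1+y) (λ a≡y → b≢1+a (cong suc (sym a≡y)))

AbsentPair-card : ∀ j → HasCard (AbsentPair (suc j)) (j ℕ.* j)
AbsentPair-card j = HasCard-image toAbsentPair (λ {p} {q} _ _ → toAbsentPair-injective p q)
  (λ q → mk⇔ (AbsentPair⇒Square q) (λ { (p , sq , refl) → Square⇒AbsentPair p sq }))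
  (Square-card j)

InjectiveBelow : ℕ → (ℕ → A) → Set
InjectiveBelow k f = ∀ {i j} → i < k → j < k → f i ≡ f j → i ≡ j

applyUpTo-DistinctChars : ∀ {f : ℕ → A} {k} → InjectiveBelow k f → DistinctChars (applyUpTo f k) k
applyUpTo-DistinctChars {f = f} {k} f-inj =
  applyUpTo f k ,
  applyUpTo⁺₁ f k (λ i<j j<k → <⇒≢ i<j ∘′ f-inj (<-trans i<j j<k) j<k) ,
  (λ _ → ⇔-id _) ,
  length-applyUpTo f k

InM₂-applyUpTo⇔ : ∀ {f : ℕ → A} {k} → InjectiveBelow k f → ∀ q →
  InM₂ (applyUpTo f k) (proj₁ q) (proj₂ q) ⇔ ∃ λ p → AbsentPair k p × Product.map f f p ≡ q
InM₂-applyUpTo⇔ {f = f} {k} f-inj (a , b) = mk⇔ M₂⇒absent absent⇒M₂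
  where
  M₂⇒absent : InM₂ (applyUpTo f k) a b → ∃ λ p → AbsentPair k p × Product.map f f p ≡ (a , b)
  M₂⇒absent m₂
    with a∈T , b∈T , absent , a≢b ← to InM₂⇔ m₂
    with x , x<k , refl ← ∈-applyUpTo⁻ f a∈T
    with y , y<k , refl ← ∈-applyUpTo⁻ f b∈T =
    (x , y) ,
    (x<k , y<k , (λ { refl → a≢b refl }) , (λ { refl → absent (Substring-applyUpTo⁺ f y<k) })) ,
    refl
  absent⇒M₂ : (∃ λ p → AbsentPair k p × Product.map f f p ≡ (a , b)) → InM₂ (applyUpTo f k) a b
  absent⇒M₂ ((x , y) , (x<k , y<k , x≢y , y≢1+x) , refl) =
    from InM₂⇔ (∈-applyUpTo⁺ f x<k , ∈-applyUpTo⁺ f y<k , absent , x≢y ∘′ f-inj x<k y<k)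
    where
    absent : ¬ Substring (f x ∷ f y ∷ []) (applyUpTo f k)
    absent factor with i , 1+i<k , fx≡fi , fy≡f1+i ← Substring-applyUpTo⁻ f k factor =
      y≢1+x (trans (f-inj y<k 1+i<k fy≡f1+i) (cong suc (sym (f-inj x<k (<-trans (n<1+n i) 1+i<k) fx≡fi))))

applyUpTo-M₂-card : ∀ {f : ℕ → A} {j} → InjectiveBelow (suc j) f →
  HasCard (λ q → InM₂ (applyUpTo f (suc j)) (proj₁ q) (proj₂ q)) (j ℕ.* j)
applyUpTo-M₂-card {f = f} {j} f-inj = HasCard-image (Product.map f f)
  (λ (x<k , y<k , _) (x′<k , y′<k , _) eq →
     cong₂ _,_ (f-inj x<k x′<k (cong proj₁ eq)) (f-inj y<k y′<k (cong proj₂ eq)))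
  (InM₂-applyUpTo⇔ f-inj)
  (AbsentPair-card j)

toℕ-mod : ∀ {i n} .{{_ : ℕ.NonZero n}} → i < n → toℕ (i mod n) ≡ i
toℕ-mod i<n = trans (toℕ-fromℕ< _) (m<n⇒m%n≡m i<n)

mod-injectiveBelow : ∀ {k n} .{{_ : ℕ.NonZero n}} → k ≤ n → InjectiveBelow k (λ i → i mod n)
mod-injectiveBelow k≤n i<k j<k eq =
  trans (sym (toℕ-mod (<-≤-trans i<k k≤n))) (trans (cong toℕ eq) (toℕ-mod (<-≤-trans j<k k≤n)))

square-as-σ[σ-2]+1 : ∀ j → + (j ℕ.* j) ≡ + suc j * (+ suc j - + 2) + + 1
square-as-σ[σ-2]+1 j = trans (ℤ.pos-* j j) (identity (+ j))
  where
  identity : ∀ (x : ℤ) → x * x ≡ (+ 1 + x) * ((+ 1 + x) - + 2) + + 1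
  identity = solve-∀

lemma10 : (σ′ : ℕ) → 1 ≤ σ′ → (n : ℕ) → σ′ ≤ n →
    Σ (List (Fin n)) λ T → DistinctChars T σ′ ×
      Σ ℕ λ m → HasCard (λ (p : Fin n × Fin n) → InM₂ T (proj₁ p) (proj₂ p)) m ×
        (+ m) ≡ (+ σ′) * ((+ σ′) - (+ 2)) + (+ 1)
-- Only injectivity on [0,σ′) matters; _mod n is just a total map ℕ → Fin n.
lemma10 (suc j) _ (suc n′) σ′≤n =
  applyUpTo (_mod suc n′) (suc j) ,
  applyUpTo-DistinctChars injective ,
  j ℕ.* j , applyUpTo-M₂-card injective , square-as-σ[σ-2]+1 j
  where
  injective : InjectiveBelow (suc j) (_mod suc n′)
  injective = mod-injectiveBelow σ′≤n
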